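{- Let $M=\{1^{k_{1}},2^{k_{2}},\ldots,m^{k_{m}}\}$ with $k_{i}\geq1$ for all $i\in[m]$, and let $\tau$ be a consecutive permutation of $[m]$. Then $F(\mathfrak{S}_{M}^{\tau})=\mathfrak{S}_{M}^{\tau}$, where $F$ is Foata's bijection.
   Context: $\mathfrak{S}_M$: words that are rearrangements of the multiset with $k_i$ copies of $i$. Tail permutation of $w$: the subword formed by the last occurrences of each letter; $\mathfrak{S}_M^\tau$: words in $\mathfrak{S}_M$ with tail permutation $\tau$. A permutation $\tau_1\cdots\tau_m$ is consecutive if each $\{\tau_1,\dots,\tau_i\}$ is a set of consecutive integers. For a word $v=v_1\cdots v_k$ and a letter $x$: if $v_k\le x$, factor $v=u_1b_1u_2b_2\cdots u_sb_s$ where each $b_i$ is a letter $\le x$ and each $u_i$ is a (possibly empty) word all of whose letters are $>x$; if $v_k>x$, factor $v=u_1b_1\cdots u_sb_s$ with each $b_i>x$ and all letters of each $u_i$ $\le x$. In both cases $J_x(v)=b_1u_1b_2u_2\cdots b_su_s$. Foata's bijection: for $w=w_1\cdots w_n$ set $\gamma_1=w_1$, $\gamma_{i+1}=J_{w_{i+1}}(\gamma_i)\,w_{i+1}$ for $1\le i\le n-1$, and $F(w)=\gamma_n$. ($F$ is a bijection of $\mathfrak{S}_M$ with $\mathrm{MAJ}(w)=\mathrm{INV}(F(w))$.) -}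

module Defs where

open import Data.Nat using (ℕ; zero; suc; _+_; _≤_; _≤ᵇ_)
open import Data.Bool using (Bool; true; false; if_then_else_; not)
open import Data.Fin using (Fin; toℕ)
open import Data.List using (List; []; _∷_; _++_; reverse; length; take; _∷ʳ_)
open import Data.List.Relation.Unary.All using (All)
open import Data.List.Relation.Binary.Permutation.Propositional using (_↭_)
open import Data.Product using (Σ; ∃; _×_)
open import Relation.Binary.PropositionalEquality using (_≡_)
open import Relation.Nullary.Decidable using (does)
import Data.Nat.Properties as ℕP

-- Words are lists of natural numbers; the alphabet of M is {1,…,m}.
Word : Set
Word = List ℕ

range : ℕ → ℕ → List ℕ
range a zero    = []
range a (suc n) = a ∷ range (suc a) n

occ : ℕ → Word → ℕ
occ x []       = 0
occ x (y ∷ ys) = if does (x ℕP.≟ y) then suc (occ x ys) else occ x ys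

-- w ∈ 𝔖_M, where M = {1^{k 0}, 2^{k 1}, …, m^{k (m-1)}}:
-- every letter lies in {1,…,m} and letter (i+1) occurs exactly k i times.
InS : (m : ℕ) → (k : Fin m → ℕ) → Word → Set
InS m k w = All (λ x → 1 ≤ x × x ≤ m) w × ((i : Fin m) → occ (suc (toℕ i)) w ≡ k i)

elem : ℕ → Word → Bool
elem x []       = false
elem x (y ∷ ys) = if does (x ℕP.≟ y) then true else elem x ys

tailPerm : Word → Word
tailPerm []       = []
tailPerm (x ∷ xs) = if elem x xs then tailPerm xs else x ∷ tailPerm xs

InSτ : (m : ℕ) → (k : Fin m → ℕ) → (τ : Word) → Word → Set
InSτ m k τ w = InS m k w × tailPerm w ≡ τ

IsPermOf : ℕ → Word → Set
IsPermOf m τ = τ ↭ range 1 m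

Consecutive : Word → Set
Consecutive τ = (i : ℕ) → 1 ≤ i → i ≤ length τ → ∃ λ a → take i τ ↭ range a i

-- J with separator predicate p: factor v = u₁b₁⋯u_sb_s where the b's are
-- exactly the letters satisfying p, output b₁u₁⋯b_su_s.
-- (acc holds the current u-block, reversed.)
Jgo : (ℕ → Bool) → List ℕ → Word → Word
Jgo p acc []       = reverse acc
Jgo p acc (y ∷ ys) = if p y then y ∷ (reverse acc ++ Jgo p [] ys) else Jgo p (y ∷ acc) ys

lastOr : ℕ → Word → ℕ
lastOr d []       = d
lastOr d (y ∷ ys) = lastOr y ys

J : ℕ → Word → Word
J x []       = []
J x (y ∷ ys) =
  if lastOr y ys ≤ᵇ x
  then Jgo (λ z → z ≤ᵇ x) [] (y ∷ ys)
  else Jgo (λ z → not (z ≤ᵇ x)) [] (y ∷ ys)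

foataGo : Word → Word → Word
foataGo γ []       = γ
foataGo γ (x ∷ xs) = foataGo (J x γ ∷ʳ x) xs

F : Word → Word
F []       = []
F (x ∷ xs) = foataGo (x ∷ []) xs

module Submission where

-- Write γᵢ for the word after i steps of Foata's algorithm on w, and w>ᵢ for the letters
-- still to be read. The tail permutation of γᵢ w>ᵢ is the same for all i: at step i+1
-- with x = wᵢ₊₁, the only letters whose last occurrence lies in γᵢ are those absent from
-- x w>ᵢ₊₁, and their last occurrences form a prefix of τ that stops before x. Since τ is
-- consecutive, that prefix is an interval of integers not containing x, so all these
-- letters lie on one side of x; J_x preserves the relative order of the letters on each
-- side of x, hence the tail permutation. Conversely J_x is invertible, so the algorithm
-- can be run backwards from any v with tail permutation τ, with the same invariant.

open import Defs
open import Data.Bool using (Bool; true; false; not; _∨_; if_then_else_; T)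
open import Data.Bool.Properties using (∨-zeroʳ; ∨-identityʳ; T-≡; not-injective)
open import Data.Fin using (Fin)
open import Data.Nat using (ℕ; zero; suc; _+_; _≤_; _<_; _≡ᵇ_; _≤ᵇ_; z≤n; s≤s)
open import Data.Nat.Properties as ℕ using (≤ᵇ-reflects-≤)
open import Data.List using ([]; _∷_; initLast; _∷ʳ′_; _++_; _ʳ++_; reverse; length; take; _∷ʳ_; [_]; filterᵇ)
open import Data.List.Properties using (length-++; ∷ʳ-++; ++-assoc; ++-identityʳ; ʳ++-defn; filter-++; filter-none)
open import Data.List.Membership.Propositional using (_∈_; _∉_)
open import Data.List.Membership.Propositional.Properties using (∈-filter⁺)
open import Data.List.Relation.Unary.All as All using (All; []; _∷_)
open import Data.List.Relation.Unary.Any using (here; there)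
open import Data.List.Relation.Binary.Permutation.Propositional using (_↭_; prep; swap; ↭-sym; ↭-trans; ↭-reflexive)
import Data.List.Relation.Binary.Permutation.Propositional as ↭
open import Data.List.Relation.Binary.Permutation.Propositional.Properties using (∈-resp-↭; ↭-length; ++⁺ˡ; ++⁺ʳ; shift; All-resp-↭; ↭-reverse)
open import Function using (_∘_; Equivalence)
open import Data.Product using (∃; _×_; _,_; proj₁; proj₂)
open import Data.Sum using (_⊎_; inj₁; inj₂)
open import Relation.Nullary using (¬_; contradiction)
open import Relation.Nullary.Decidable using (proof; T?)
open import Relation.Nullary.Reflects using (Reflects; ofʸ; ofⁿ)
open import Relation.Binary.PropositionalEquality using (_≡_; refl; sym; trans; cong; subst; module ≡-Reasoning)

≡ᵇ-reflects-≡ : ∀ m n → Reflects (m ≡ n) (m ≡ᵇ n)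
≡ᵇ-reflects-≡ m n = proof (m ℕ.≟ n)

elem⇒∈ : ∀ {x} u → elem x u ≡ true → x ∈ u
elem⇒∈ {x} (y ∷ u) e with x ≡ᵇ y | ≡ᵇ-reflects-≡ x y
... | true  | ofʸ x≡y = here x≡y
... | false | ofⁿ _   = there (elem⇒∈ u e)

elem-++ : ∀ x u v → elem x (u ++ v) ≡ elem x u ∨ elem x v
elem-++ x []      v = refl
elem-++ x (y ∷ u) v with x ≡ᵇ y
... | true  = refl
... | false = elem-++ x u v

elem-filterᵇ : ∀ q {x} → q x ≡ true → ∀ u → elem x (filterᵇ q u) ≡ elem x u
elem-filterᵇ q qx [] = refl
elem-filterᵇ q {x} qx (y ∷ u) with q y in qy
... | true with x ≡ᵇ y
...   | true  = refl
...   | false = elem-filterᵇ q qx u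
elem-filterᵇ q {x} qx (y ∷ u) | false with x ≡ᵇ y | ≡ᵇ-reflects-≡ x y
...   | true  | ofʸ refl = contradiction (trans (sym qx) qy) λ ()
...   | false | _        = elem-filterᵇ q qx u

notIn : Word → ℕ → Bool
notIn v z = not (elem z v)

∈-tailPerm : ∀ {z} u → z ∈ u → z ∈ tailPerm u
∈-tailPerm (y ∷ u) z∈u with elem y u in y∈?u | z∈u
... | true  | here refl  = ∈-tailPerm u (elem⇒∈ u y∈?u)
... | true  | there z∈u′ = ∈-tailPerm u z∈u′
... | false | here z≡y   = here z≡y
... | false | there z∈u′ = there (∈-tailPerm u z∈u′)

tailPerm-++ : ∀ u v → tailPerm (u ++ v) ≡ tailPerm (filterᵇ (notIn v) u) ++ tailPerm v
tailPerm-++ []      v = refl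
tailPerm-++ (y ∷ u) v rewrite elem-++ y u v with elem y v in y∈?v
... | true  rewrite ∨-zeroʳ (elem y u) = tailPerm-++ u v
... | false rewrite ∨-identityʳ (elem y u)
                  | elem-filterᵇ (notIn v) (cong not y∈?v) u with elem y u
...   | true  = tailPerm-++ u v
...   | false = cong (y ∷_) (tailPerm-++ u v)

occ-++ : ∀ z u v → occ z (u ++ v) ≡ occ z u + occ z v
occ-++ z []      v = refl
occ-++ z (y ∷ u) v with z ≡ᵇ y
... | true  = cong suc (occ-++ z u v)
... | false = occ-++ z u v

occ-∈ : ∀ {z u} → z ∈ u → 1 ≤ occ z u
occ-∈ {z} {y ∷ u} z∈u with z ≡ᵇ y | ≡ᵇ-reflects-≡ z y | z∈u
... | true  | _       | _          = s≤s z≤n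
... | false | ofⁿ z≢y | here z≡y   = contradiction z≡y z≢y
... | false | _       | there z∈u′ = occ-∈ z∈u′

occ-↭ : ∀ z {u v} → u ↭ v → occ z u ≡ occ z v
occ-↭ z ↭.refl = refl
occ-↭ z (prep y u↭v) with z ≡ᵇ y
... | true  = cong suc (occ-↭ z u↭v)
... | false = occ-↭ z u↭v
occ-↭ z (swap x y u↭v) with z ≡ᵇ x | z ≡ᵇ y
... | true  | true  = cong (λ n → suc (suc n)) (occ-↭ z u↭v)
... | true  | false = cong suc (occ-↭ z u↭v)
... | false | true  = cong suc (occ-↭ z u↭v)
... | false | false = occ-↭ z u↭v
occ-↭ z (↭.trans u↭w w↭v) = trans (occ-↭ z u↭w) (occ-↭ z w↭v)

InS-resp-↭ : ∀ m k {u v} → u ↭ v → InS m k u → InS m k v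
InS-resp-↭ m k u↭v (letters , counts) =
  All-resp-↭ u↭v letters , λ i → trans (sym (occ-↭ _ u↭v)) (counts i)

∉-range-below : ∀ {z a} n → z < a → occ z (range a n) ≡ 0
∉-range-below zero    z<a = refl
∉-range-below {z} {a} (suc n) z<a with z ≡ᵇ a | ≡ᵇ-reflects-≡ z a
... | true  | ofʸ refl = contradiction z<a (ℕ.<-irrefl refl)
... | false | _        = ∉-range-below n (ℕ.m<n⇒m<1+n z<a)

occ-range≤1 : ∀ z a n → occ z (range a n) ≤ 1
occ-range≤1 z a zero = z≤n
occ-range≤1 z a (suc n) with z ≡ᵇ a | ≡ᵇ-reflects-≡ z a
... | true  | ofʸ refl rewrite ∉-range-below {z} n (ℕ.n<1+n z) = s≤s z≤n
... | false | _        = occ-range≤1 z (suc a) n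

∈-range⁻ : ∀ {z a} n → z ∈ range a n → a ≤ z × z < a + n
∈-range⁻ {a = a} (suc n) (here refl) = ℕ.≤-refl , ℕ.m<m+n a (s≤s z≤n)
∈-range⁻ {z} {a} (suc n) (there z∈r) with ∈-range⁻ n z∈r
... | 1+a≤z , z<1+a+n = ℕ.<⇒≤ 1+a≤z , subst (z <_) (sym (ℕ.+-suc a n)) z<1+a+n

∉-range⁻ : ∀ {z a} n → z ∉ range a n → z < a ⊎ a + n ≤ z
∉-range⁻ {z} {a} zero _ rewrite ℕ.+-identityʳ a with ℕ.≤-<-connex a z
... | inj₁ a≤z = inj₂ a≤z
... | inj₂ z<a = inj₁ z<a
∉-range⁻ {z} {a} (suc n) z∉r with ∉-range⁻ n (z∉r ∘ there)
... | inj₁ z<1+a = inj₁ (ℕ.≤∧≢⇒< (ℕ.≤-pred z<1+a) (z∉r ∘ here))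
... | inj₂ 1+a+n≤z = inj₂ (subst (_≤ z) (sym (ℕ.+-suc a n)) 1+a+n≤z)

take-length-++ : ∀ (u v : Word) → take (length u) (u ++ v) ≡ u
take-length-++ []      v = refl
take-length-++ (y ∷ u) v = cong (y ∷_) (take-length-++ u v)

≤ᵇ≡true : ∀ {m n} → m ≤ n → (m ≤ᵇ n) ≡ true
≤ᵇ≡true {m} {n} m≤n with m ≤ᵇ n | ≤ᵇ-reflects-≤ m n
... | true  | _       = refl
... | false | ofⁿ m≰n = contradiction m≤n m≰n

≤ᵇ≡false : ∀ {m n} → n < m → (m ≤ᵇ n) ≡ false
≤ᵇ≡false {m} {n} n<m with m ≤ᵇ n | ≤ᵇ-reflects-≤ m n
... | true  | ofʸ m≤n = contradiction m≤n (ℕ.<⇒≱ n<m)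
... | false | _       = refl

consecutive-prefix-one-sided : ∀ {τ} → Consecutive τ → (∀ z → occ z τ ≤ 1) →
  ∀ {A T x} → A ++ T ≡ τ → x ∈ T → ∃ λ c → All (λ z → (z ≤ᵇ x) ≡ c) A
consecutive-prefix-one-sided τ-cons τ-simple {[]} _ _ = true , []
consecutive-prefix-one-sided τ-cons τ-simple {A@(_ ∷ _)} {T} {x} refl x∈T
  with τ-cons (length A) (s≤s z≤n) (subst (length A ≤_) (sym (length-++ A)) (ℕ.m≤m+n _ _))
... | a , prefix↭range = one-sided (∉-range⁻ (length A) (x∉A ∘ ∈-resp-↭ (↭-sym A↭range)))
  where
  A↭range : A ↭ range a (length A)
  A↭range = subst (_↭ range a (length A)) (take-length-++ A T) prefix↭range
  x∉A : x ∉ A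
  x∉A x∈A = ℕ.<⇒≱ (subst (1 <_) (sym (occ-++ x A T)) (ℕ.+-mono-≤ (occ-∈ x∈A) (occ-∈ x∈T))) (τ-simple x)
  bounds : ∀ {z} → z ∈ A → a ≤ z × z < a + length A
  bounds z∈A = ∈-range⁻ (length A) (∈-resp-↭ A↭range z∈A)
  one-sided : x < a ⊎ a + length A ≤ x → ∃ λ c → All (λ z → (z ≤ᵇ x) ≡ c) A
  one-sided (inj₁ x<a)   = false , All.tabulate λ z∈A → ≤ᵇ≡false (ℕ.<-≤-trans x<a (proj₁ (bounds z∈A)))
  one-sided (inj₂ a+n≤x) = true  , All.tabulate λ z∈A → ≤ᵇ≡true (ℕ.<⇒≤ (ℕ.<-≤-trans (proj₂ (bounds z∈A)) a+n≤x))

length-∷ʳ : ∀ (v : Word) x → length (v ∷ʳ x) ≡ suc (length v)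
length-∷ʳ v x = trans (length-++ v) (ℕ.+-comm (length v) 1)

reverse-∷-++ : ∀ y (acc v : Word) → reverse (y ∷ acc) ++ v ≡ reverse acc ++ y ∷ v
reverse-∷-++ y acc v = trans (sym (ʳ++-defn (y ∷ acc))) (ʳ++-defn acc)

Jgo-↭ : ∀ p acc v → Jgo p acc v ↭ reverse acc ++ v
Jgo-↭ p acc []       = ↭-reflexive (sym (++-identityʳ (reverse acc)))
Jgo-↭ p acc (y ∷ ys) with p y
... | true  = ↭-trans (prep y (++⁺ˡ (reverse acc) (Jgo-↭ p [] ys))) (↭-sym (shift y (reverse acc) ys))
... | false = ↭-trans (Jgo-↭ p (y ∷ acc) ys) (↭-reflexive (reverse-∷-++ y acc ys))

J-↭ : ∀ x v → J x v ↭ v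
J-↭ x []       = ↭.refl
J-↭ x (y ∷ ys) with lastOr y ys ≤ᵇ x
... | true  = Jgo-↭ (_≤ᵇ x) [] (y ∷ ys)
... | false = Jgo-↭ (not ∘ (_≤ᵇ x)) [] (y ∷ ys)

filterᵇ-++ : ∀ q (u v : Word) → filterᵇ q (u ++ v) ≡ filterᵇ q u ++ filterᵇ q v
filterᵇ-++ q = filter-++ (T? ∘ q)

module _ (p q : ℕ → Bool) (c : Bool) where

  q⇒p≡c : ℕ → Set
  q⇒p≡c z = q z ≡ true → p z ≡ c

  filterᵇ-Jgo : ∀ acc v → All (λ z → p z ≡ false) acc → All q⇒p≡c acc → All q⇒p≡c v →
                filterᵇ q (Jgo p acc v) ≡ filterᵇ q (reverse acc ++ v)
  filterᵇ-Jgo acc []       _ _ _ = cong (filterᵇ q) (sym (++-identityʳ (reverse acc)))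
  filterᵇ-Jgo acc (y ∷ ys) acc-not-p acc-sep (y-sep ∷ ys-sep) with p y in py
  ... | false = trans (filterᵇ-Jgo (y ∷ acc) ys (py ∷ acc-not-p) ((λ qy → trans py (y-sep qy)) ∷ acc-sep) ys-sep)
                      (cong (filterᵇ q) (reverse-∷-++ y acc ys))
  ... | true = begin
    filterᵇ q ([ y ] ++ reverse acc ++ Jgo p [] ys)
      ≡⟨ trans (filterᵇ-++ q [ y ] _) (cong (fq [ y ] ++_) (filterᵇ-++ q (reverse acc) _)) ⟩
    fq [ y ] ++ fq (reverse acc) ++ fq (Jgo p [] ys)
      ≡⟨ cong (λ t → fq [ y ] ++ fq (reverse acc) ++ t) (filterᵇ-Jgo [] ys [] [] ys-sep) ⟩
    fq [ y ] ++ fq (reverse acc) ++ fq ys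
      ≡⟨ sym (++-assoc (fq [ y ]) _ _) ⟩
    (fq [ y ] ++ fq (reverse acc)) ++ fq ys
      ≡⟨ cong (_++ fq ys) commute ⟩
    (fq (reverse acc) ++ fq [ y ]) ++ fq ys
      ≡⟨ trans (++-assoc (fq (reverse acc)) _ _) (cong (fq (reverse acc) ++_) (sym (filterᵇ-++ q [ y ] ys))) ⟩
    fq (reverse acc) ++ fq (y ∷ ys)
      ≡⟨ sym (filterᵇ-++ q (reverse acc) (y ∷ ys)) ⟩
    fq (reverse acc ++ y ∷ ys) ∎
    where
    open ≡-Reasoning
    fq = filterᵇ q
    -- Either y is not a q-letter, or c is true and the non-separators in acc contain no q-letter.
    commute : fq [ y ] ++ fq (reverse acc) ≡ fq (reverse acc) ++ fq [ y ]
    commute with q y in qy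
    ... | false = sym (++-identityʳ _)
    ... | true  = trans (cong ([ y ] ++_) none) (cong (_++ [ y ]) (sym none))
      where
      acc-not-q : All (λ z → ¬ T (q z)) acc
      acc-not-q = All.zipWith (λ (pz≡false , z-sep) qz →
        contradiction (trans (sym pz≡false) (trans (z-sep (Equivalence.to T-≡ qz)) (sym (y-sep refl)))) λ ())
        (acc-not-p , acc-sep)
      none : fq (reverse acc) ≡ []
      none = filter-none (T? ∘ q) (All-resp-↭ (↭-sym (↭-reverse acc)) acc-not-q)

filterᵇ-J : ∀ q x c δ → All (λ z → q z ≡ true → (z ≤ᵇ x) ≡ c) δ → filterᵇ q (J x δ) ≡ filterᵇ q δ
filterᵇ-J q x c []       _ = refl
filterᵇ-J q x c (y ∷ ys) δ-sep with lastOr y ys ≤ᵇ x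
... | true  = filterᵇ-Jgo (_≤ᵇ x) q c [] (y ∷ ys) [] [] δ-sep
... | false = filterᵇ-Jgo (not ∘ (_≤ᵇ x)) q (not c) [] (y ∷ ys) [] [] (All.map (cong not ∘_) δ-sep)

-- b is the separator pending to be placed after the block acc, which is kept reversed.
Jgo⁻¹ : (ℕ → Bool) → ℕ → Word → Word → Word
Jgo⁻¹ p b acc []       = acc ʳ++ [ b ]
Jgo⁻¹ p b acc (y ∷ ys) = if p y then acc ʳ++ b ∷ Jgo⁻¹ p y [] ys else Jgo⁻¹ p b (y ∷ acc) ys

J⁻¹ : ℕ → Word → Word
J⁻¹ x []       = []
J⁻¹ x (b ∷ bs) = if b ≤ᵇ x then Jgo⁻¹ (_≤ᵇ x) b [] bs else Jgo⁻¹ (not ∘ (_≤ᵇ x)) b [] bs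

Jgo-ʳ++ : ∀ p A acc r → All (λ z → p z ≡ false) acc → Jgo p A (acc ʳ++ r) ≡ Jgo p (acc ++ A) r
Jgo-ʳ++ p A []        r []                       = refl
Jgo-ʳ++ p A (z ∷ acc) r (pz≡false ∷ acc-not-p) rewrite Jgo-ʳ++ p A acc (z ∷ r) acc-not-p | pz≡false = refl

Jgo-Jgo⁻¹ : ∀ p b acc ys → p b ≡ true → All (λ z → p z ≡ false) acc →
            Jgo p [] (Jgo⁻¹ p b acc ys) ≡ b ∷ acc ʳ++ ys
Jgo-Jgo⁻¹ p b acc [] pb acc-not-p
  rewrite Jgo-ʳ++ p [] acc [ b ] acc-not-p | ++-identityʳ acc | pb = cong (b ∷_) (sym (ʳ++-defn acc))
Jgo-Jgo⁻¹ p b acc (y ∷ ys) pb acc-not-p with p y in py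
... | true rewrite Jgo-ʳ++ p [] acc (b ∷ Jgo⁻¹ p y [] ys) acc-not-p | ++-identityʳ acc | pb
  = cong (b ∷_) (trans (cong (reverse acc ++_) (Jgo-Jgo⁻¹ p y [] ys py [])) (sym (ʳ++-defn acc)))
... | false = Jgo-Jgo⁻¹ p b (y ∷ acc) ys pb (py ∷ acc-not-p)

lastOr-ʳ++ : ∀ d acc y v → lastOr d (acc ʳ++ y ∷ v) ≡ lastOr y v
lastOr-ʳ++ d []        y v = refl
lastOr-ʳ++ d (z ∷ acc) y v = lastOr-ʳ++ d acc z (y ∷ v)

lastOr-Jgo⁻¹ : ∀ (p : ℕ → Bool) d b acc ys → p b ≡ true → p (lastOr d (Jgo⁻¹ p b acc ys)) ≡ true
lastOr-Jgo⁻¹ p d b acc []       pb rewrite lastOr-ʳ++ d acc b [] = pb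
lastOr-Jgo⁻¹ p d b acc (y ∷ ys) pb with p y in py
... | true rewrite lastOr-ʳ++ d acc b (Jgo⁻¹ p y [] ys) = lastOr-Jgo⁻¹ p b y [] ys py
... | false = lastOr-Jgo⁻¹ p d b (y ∷ acc) ys pb

J-last≤ : ∀ x v → (lastOr 0 v ≤ᵇ x) ≡ true → J x v ≡ Jgo (_≤ᵇ x) [] v
J-last≤ x []       _ = refl
J-last≤ x (y ∷ ys) last≤x rewrite last≤x = refl

J-last> : ∀ x v → (lastOr 0 v ≤ᵇ x) ≡ false → J x v ≡ Jgo (not ∘ (_≤ᵇ x)) [] v
J-last> x []       _ = refl
J-last> x (y ∷ ys) last>x rewrite last>x = refl

J-J⁻¹ : ∀ x v → J x (J⁻¹ x v) ≡ v
J-J⁻¹ x []       = refl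
J-J⁻¹ x (b ∷ bs) with b ≤ᵇ x in b≤ᵇx
... | true  = trans (J-last≤ x (Jgo⁻¹ (_≤ᵇ x) b [] bs) (lastOr-Jgo⁻¹ (_≤ᵇ x) 0 b [] bs b≤ᵇx))
                    (Jgo-Jgo⁻¹ (_≤ᵇ x) b [] bs b≤ᵇx [])
... | false = trans (J-last> x (Jgo⁻¹ (not ∘ (_≤ᵇ x)) b [] bs) (not-injective {y = false} (lastOr-Jgo⁻¹ (not ∘ (_≤ᵇ x)) 0 b [] bs (cong not b≤ᵇx))))
                    (Jgo-Jgo⁻¹ (not ∘ (_≤ᵇ x)) b [] bs (cong not b≤ᵇx) [])

foataGo-↭ : ∀ γ xs → foataGo γ xs ↭ γ ++ xs
foataGo-↭ γ []       = ↭-reflexive (sym (++-identityʳ γ))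
foataGo-↭ γ (x ∷ xs) = ↭-trans (foataGo-↭ (J x γ ∷ʳ x) xs)
  (↭-trans (↭-reflexive (∷ʳ-++ (J x γ) x xs)) (++⁺ʳ (x ∷ xs) (J-↭ x γ)))

F≡foataGo : ∀ w → F w ≡ foataGo [] w
F≡foataGo []      = refl
F≡foataGo (x ∷ w) = refl

F-↭ : ∀ w → F w ↭ w
F-↭ w = subst (_↭ w) (sym (F≡foataGo w)) (foataGo-↭ [] w)

foataGo-++ : ∀ γ u v → foataGo γ (u ++ v) ≡ foataGo (foataGo γ u) v
foataGo-++ γ []      v = refl
foataGo-++ γ (x ∷ u) v = foataGo-++ (J x γ ∷ʳ x) u v

F-∷ʳ : ∀ w x → F (w ∷ʳ x) ≡ J x (F w) ∷ʳ x
F-∷ʳ w x = trans (F≡foataGo (w ∷ʳ x))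
  (trans (foataGo-++ [] w [ x ]) (cong (λ γ → J x γ ∷ʳ x) (sym (F≡foataGo w))))

module TailPermutation {τ : Word} (τ-simple : ∀ z → occ z τ ≤ 1) (τ-cons : Consecutive τ) where

  J-preserves-tailPerm : ∀ x γ {u} xs → u ↭ γ → tailPerm (u ++ x ∷ xs) ≡ τ →
                         tailPerm (J x γ ++ x ∷ xs) ≡ tailPerm (γ ++ x ∷ xs)
  J-preserves-tailPerm x γ {u} xs u↭γ u-tail
    with consecutive-prefix-one-sided τ-cons τ-simple (trans (sym (tailPerm-++ u (x ∷ xs))) u-tail)
                                      (∈-tailPerm (x ∷ xs) (here refl))
  ... | c , one-sided = begin
    tailPerm (J x γ ++ x ∷ xs)                   ≡⟨ tailPerm-++ (J x γ) (x ∷ xs) ⟩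
    tailPerm (filterᵇ q (J x γ)) ++ tailPerm (x ∷ xs)
      ≡⟨ cong (λ t → tailPerm t ++ tailPerm (x ∷ xs)) (filterᵇ-J q x c γ γ-separated) ⟩
    tailPerm (filterᵇ q γ) ++ tailPerm (x ∷ xs)  ≡⟨ sym (tailPerm-++ γ (x ∷ xs)) ⟩
    tailPerm (γ ++ x ∷ xs)                       ∎
    where
    open ≡-Reasoning
    q = notIn (x ∷ xs)
    γ-separated : All (λ z → q z ≡ true → (z ≤ᵇ x) ≡ c) γ
    γ-separated = All.tabulate λ z∈γ qz → All.lookup one-sided
      (∈-tailPerm _ (∈-filter⁺ (T? ∘ q) (∈-resp-↭ (↭-sym u↭γ) z∈γ) (Equivalence.from T-≡ qz)))

  foataGo-tailPerm : ∀ γ xs → tailPerm (γ ++ xs) ≡ τ → tailPerm (foataGo γ xs) ≡ τ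
  foataGo-tailPerm γ []       γ-tail = trans (cong tailPerm (sym (++-identityʳ γ))) γ-tail
  foataGo-tailPerm γ (x ∷ xs) γ-tail = foataGo-tailPerm (J x γ ∷ʳ x) xs (begin
    tailPerm ((J x γ ∷ʳ x) ++ xs) ≡⟨ cong tailPerm (∷ʳ-++ (J x γ) x xs) ⟩
    tailPerm (J x γ ++ x ∷ xs)    ≡⟨ J-preserves-tailPerm x γ xs ↭.refl γ-tail ⟩
    tailPerm (γ ++ x ∷ xs)        ≡⟨ γ-tail ⟩
    τ                             ∎)
    where open ≡-Reasoning

  F-tailPerm : ∀ w → tailPerm w ≡ τ → tailPerm (F w) ≡ τ
  F-tailPerm w w-tail = trans (cong tailPerm (F≡foataGo w))
    (foataGo-tailPerm [] w w-tail)

  F-preimage-++ : ∀ n v → length v ≡ n → ∀ xs → tailPerm (v ++ xs) ≡ τ →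
                  ∃ λ w → F w ≡ v × tailPerm (w ++ xs) ≡ τ
  F-preimage-++ zero    []      _ xs v-tail = [] , refl , v-tail
  F-preimage-++ (suc n) v |v| xs v-tail with initLast v
  F-preimage-++ (suc n) .(v′ ∷ʳ x) |v| xs v-tail | v′ ∷ʳ′ x
    with F-preimage-++ n δ |δ| (x ∷ xs) δ-tail
    where
    δ = J⁻¹ x v′
    |δ| : length δ ≡ n
    |δ| = trans (sym (↭-length (J-↭ x δ)))
      (trans (cong length (J-J⁻¹ x v′)) (ℕ.suc-injective (trans (sym (length-∷ʳ v′ x)) |v|)))
    Jδ-tail : tailPerm (J x δ ++ x ∷ xs) ≡ τ
    Jδ-tail = trans (cong (λ γ → tailPerm (γ ++ x ∷ xs)) (J-J⁻¹ x v′))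
                    (trans (cong tailPerm (sym (∷ʳ-++ v′ x xs))) v-tail)
    δ-tail : tailPerm (δ ++ x ∷ xs) ≡ τ
    δ-tail = trans (sym (J-preserves-tailPerm x δ xs (J-↭ x δ) Jδ-tail)) Jδ-tail
  ... | w , Fw≡δ , w-tail = w ∷ʳ x , Fwx≡v , trans (cong tailPerm (∷ʳ-++ w x xs)) w-tail
    where
    Fwx≡v : F (w ∷ʳ x) ≡ v′ ∷ʳ x
    Fwx≡v = trans (F-∷ʳ w x) (cong (_∷ʳ x) (trans (cong (J x) Fw≡δ) (J-J⁻¹ x v′)))

  F-preimage : ∀ v → tailPerm v ≡ τ → ∃ λ w → F w ≡ v × tailPerm w ≡ τ
  F-preimage v v-tail with F-preimage-++ (length v) v refl [] (trans (cong tailPerm (++-identityʳ v)) v-tail)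
  ... | w , Fw≡v , w-tail = w , Fw≡v , trans (cong tailPerm (sym (++-identityʳ w))) w-tail

proposition3p3 : (m : ℕ) → (k : Fin m → ℕ) → ((i : Fin m) → 1 ≤ k i) →
    (τ : Word) → IsPermOf m τ → Consecutive τ →
    ((w : Word) → InSτ m k τ w → InSτ m k τ (F w)) ×
    ((v : Word) → InSτ m k τ v → ∃ λ w → InSτ m k τ w × F w ≡ v)
proposition3p3 m k _ τ τ↭range τ-cons = forward , backward
  where
  τ-simple : ∀ z → occ z τ ≤ 1
  τ-simple z = subst (_≤ 1) (sym (occ-↭ z τ↭range)) (occ-range≤1 z 1 m)
  open TailPermutation τ-simple τ-cons

  forward : (w : Word) → InSτ m k τ w → InSτ m k τ (F w)
  forward w (w∈S , w-tail) = InS-resp-↭ m k (↭-sym (F-↭ w)) w∈S , F-tailPerm w w-tail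

  backward : (v : Word) → InSτ m k τ v → ∃ λ w → InSτ m k τ w × F w ≡ v
  backward v (v∈S , v-tail) with F-preimage v v-tail
  ... | w , Fw≡v , w-tail = w , (InS-resp-↭ m k (subst (_↭ w) Fw≡v (F-↭ w)) v∈S , w-tail) , Fw≡v
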